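{- Let $R$ be a $q$-torsion free commutative ring ($q\in R$) and let $n,r$ be integers with $r>n/2$. Then the groups $$N_{n,r}(R,q)=\{f\in A_n(R,q): f(T)\equiv T\bmod q^r\},\qquad K_{n,r}(R,q)=\{f\in\mathrm{Aut}(\mathbb{A}^1_{R/q^n}): f(T)\equiv T\bmod q^r\}$$ (the kernels of reduction $A_n(R,q)\to A_r(R,q)$ and $\mathrm{Aut}(\mathbb{A}^1_{R/q^n})\to\mathrm{Aut}(\mathbb{A}^1_{R/q^r})$ respectively) are abelian.
   Context: For a commutative ring $B$, $\mathrm{Aut}(\mathbb{A}^1_B)$ denotes the group of polynomials $f\in B[T]$ invertible under composition, with group law composition. $A_n(R,q)$ is the subgroup of $\mathrm{Aut}(\mathbb{A}^1_{R/q^n})$ consisting of invertible polynomials of the form $a_0+a_1T+qa_2T^2+q^2a_3T^3+\cdots+q^{n-1}a_nT^n \bmod q^n$ with $a_i\in R$. -}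

module Defs where

open import Level using (_⊔_)
open import Algebra.Bundles using (CommutativeRing)
open import Data.Nat using (ℕ; zero; suc)
open import Data.List using (List; []; _∷_)
open import Data.Vec using (Vec; []; _∷_)
open import Data.Product using (Σ; ∃; _×_)

-- Polynomials over a commutative ring R, represented by coefficient lists
-- (constant term first).  A polynomial over R/q^m is represented by any
-- lift to R[T]; equality in (R/q^m)[T] is coefficientwise congruence mod q^m.
module PolyDefs {c ℓ} (R : CommutativeRing c ℓ) where
  open CommutativeRing R

  Poly : Set c
  Poly = List Carrier

  pow : Carrier → ℕ → Carrier
  pow x zero = 1#
  pow x (suc m) = x * pow x m

  _≡_[mod_] : Carrier → Carrier → Carrier → Set (c ⊔ ℓ)
  a ≡ b [mod x ] = ∃ λ d → a ≈ b + x * d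

  TorsionFree : Carrier → Set (c ⊔ ℓ)
  TorsionFree q = ∀ x → q * x ≈ 0# → x ≈ 0#

  coeff : Poly → ℕ → Carrier
  coeff [] i = 0#
  coeff (a ∷ f) zero = a
  coeff (a ∷ f) (suc i) = coeff f i

  addP : Poly → Poly → Poly
  addP [] g = g
  addP (a ∷ f) [] = a ∷ f
  addP (a ∷ f) (b ∷ g) = (a + b) ∷ addP f g

  scaleP : Carrier → Poly → Poly
  scaleP a [] = []
  scaleP a (b ∷ f) = (a * b) ∷ scaleP a f

  mulP : Poly → Poly → Poly
  mulP [] g = []
  mulP (a ∷ f) g = addP (scaleP a g) (0# ∷ mulP f g)

  compP : Poly → Poly → Poly
  compP [] g = []
  compP (a ∷ f) g = addP (a ∷ []) (mulP g (compP f g))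

  X : Poly
  X = 0# ∷ 1# ∷ []

  _≡ₚ_[mod_^_] : Poly → Poly → Carrier → ℕ → Set (c ⊔ ℓ)
  f ≡ₚ g [mod q ^ m ] = ∀ i → coeff f i ≡ coeff g i [mod pow q m ]

  InAut : Carrier → ℕ → Poly → Set (c ⊔ ℓ)
  InAut q m f = ∃ λ g → (compP f g ≡ₚ X [mod q ^ m ]) × (compP g f ≡ₚ X [mod q ^ m ])

  -- a₀ + a₁T + q a₂T² + … + q^{n-1} aₙTⁿ from (a₀, …, aₙ)
  shapeTail : Carrier → ℕ → ∀ {k} → Vec Carrier k → Poly
  shapeTail q j [] = []
  shapeTail q j (a ∷ as) = (pow q j * a) ∷ shapeTail q (suc j) as

  shape : Carrier → ∀ {n} → Vec Carrier (suc n) → Poly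
  shape q (a₀ ∷ as) = a₀ ∷ shapeTail q 0 as

  InA : Carrier → ℕ → Poly → Set (c ⊔ ℓ)
  InA q n f = InAut q n f × (∃ λ (a : Vec Carrier (suc n)) → f ≡ₚ shape q a [mod q ^ n ])

  -- the class of f (mod q^n) lies in K_{n,r}(R,q):  f ≡ T mod q^r
  -- (reduction mod q^{min r n}; for r ≤ n this is the paper's condition)
  InK : Carrier → ℕ → ℕ → Poly → Set (c ⊔ ℓ)
  InK q n r f = InAut q n f × (f ≡ₚ X [mod q ^ (r Data.Nat.⊓ n) ])

  InN : Carrier → ℕ → ℕ → Poly → Set (c ⊔ ℓ)
  InN q n r f = InA q n f × (f ≡ₚ X [mod q ^ (r Data.Nat.⊓ n) ])

  Cor4p5 : Set (c ⊔ ℓ)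
  Cor4p5 = (q : Carrier) → TorsionFree q → (n r : ℕ) → n Data.Nat.< 2 Data.Nat.* r →
    (∀ f g → InN q n r f → InN q n r g → compP f g ≡ₚ compP g f [mod q ^ n ])
    × (∀ f g → InK q n r f → InK q n r g → compP f g ≡ₚ compP g f [mod q ^ n ])

module Submission where

-- Write s = min(r,n) and a = q^s, so that a² is a
-- multiple of q^n.  If f ≡ T and g ≡ T (mod a), then f = T + a·u exactly for
-- some polynomial u, and, since composition is additive in its first argument,
--     f ∘ g = g + a·(u ∘ g) ≡ g + a·u   (mod a²),
-- because u ∘ g ≡ u ∘ T = u (mod a).  Writing g = T + a·v gives
-- f ∘ g ≡ T + a·u + a·v (mod a²), which is symmetric in f and g.

open import Defs
open import Algebra.Bundles using (CommutativeRing)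
open import Level using (_⊔_)
open import Data.Nat as ℕ using (ℕ; zero; suc)
import Data.Nat.Properties as ℕₚ
open import Data.List using ([]; _∷_)
open import Data.Product using (Σ; _,_; proj₂)
open import Data.Sum using (inj₁; inj₂)
open import Relation.Binary.Bundles using (Setoid)
import Relation.Binary.Reasoning.Setoid as SetoidReasoning
import Relation.Binary.PropositionalEquality as P

module Proof {c ℓ} (R : CommutativeRing c ℓ) where
  open CommutativeRing R hiding (zero)
  open PolyDefs R
  open import Algebra.Solver.Ring.NaturalCoefficients.Default commutativeSemiring

  ≈⇒mod : ∀ {m x y} → x ≈ y → x ≡ y [mod m ]
  ≈⇒mod {m} {x} {y} x≈y = 0# , trans x≈y (solve 2 (λ y m → y := y :+ m :* con 0) refl y m)

  mod-refl : ∀ {m x} → x ≡ x [mod m ]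
  mod-refl = ≈⇒mod refl

  mod-sym : ∀ {m x y} → x ≡ y [mod m ] → y ≡ x [mod m ]
  mod-sym {m} {x} {y} (d , x≈y+md) = - d , sym (begin
    x + m * - d          ≈⟨ +-congʳ x≈y+md ⟩
    y + m * d + m * - d  ≈⟨ solve 4 (λ y m d e → y :+ m :* d :+ m :* e := y :+ m :* (d :+ e)) refl y m d (- d) ⟩
    y + m * (d + - d)    ≈⟨ +-congˡ (*-congˡ (-‿inverseʳ d)) ⟩
    y + m * 0#           ≈⟨ solve 2 (λ y m → y :+ m :* con 0 := y) refl y m ⟩
    y                    ∎)
    where open SetoidReasoning setoid

  mod-trans : ∀ {m x y z} → x ≡ y [mod m ] → y ≡ z [mod m ] → x ≡ z [mod m ]
  mod-trans {m} {z = z} (d , x≈) (d′ , y≈) = d′ + d ,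
    trans x≈ (trans (+-congʳ y≈) (solve 4 (λ z m d′ d → z :+ m :* d′ :+ m :* d := z :+ m :* (d′ :+ d)) refl z m d′ d))

  mod-+ : ∀ {m x x′ y y′} → x ≡ x′ [mod m ] → y ≡ y′ [mod m ] → (x + y) ≡ (x′ + y′) [mod m ]
  mod-+ {m} {x′ = x′} {y′ = y′} (d , x≈) (d′ , y≈) = d + d′ ,
    trans (+-cong x≈ y≈) (solve 5 (λ x y m d d′ → x :+ m :* d :+ (y :+ m :* d′) := x :+ y :+ m :* (d :+ d′)) refl x′ y′ m d d′)

  mod-* : ∀ {m x x′ y y′} → x ≡ x′ [mod m ] → y ≡ y′ [mod m ] → (x * y) ≡ (x′ * y′) [mod m ]
  mod-* {m} {x′ = x′} {y′ = y′} (d , x≈) (d′ , y≈) = d * y′ + x′ * d′ + m * d * d′ ,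
    trans (*-cong x≈ y≈) (solve 5 (λ x y m d d′ → (x :+ m :* d) :* (y :+ m :* d′)
                                      := x :* y :+ m :* (d :* y :+ x :* d′ :+ m :* d :* d′)) refl x′ y′ m d d′)

  mod-scale : ∀ {a x y} → x ≡ y [mod a ] → (a * x) ≡ (a * y) [mod a * a ]
  mod-scale {a} {y = y} (d , x≈) = d ,
    trans (*-congˡ x≈) (solve 3 (λ a y d → a :* (y :+ a :* d) := a :* y :+ a :* a :* d) refl a y d)

  mod-weaken : ∀ {m b k x y} → m ≈ b * k → x ≡ y [mod m ] → x ≡ y [mod b ]
  mod-weaken {m} {b} {k} m≈bk (d , x≈) = k * d , trans x≈ (+-congˡ (trans (*-congʳ m≈bk) (*-assoc b k d)))

  -- Exact equality in R[T]: lists differing by trailing zeros are equal.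
  record _≋_ (f g : Poly) : Set ℓ where
    constructor exactly
    field coeff-≈ : ∀ i → coeff f i ≈ coeff g i
  open _≋_

  -- Equality in (R/m)[T].  A record, so that the modulus m can be inferred.
  record _≃_[mod_] (f g : Poly) (m : Carrier) : Set (c ⊔ ℓ) where
    constructor coeffwise
    field at : ∀ i → coeff f i ≡ coeff g i [mod m ]
  open _≃_[mod_]

  ≋⇒≃ : ∀ {m f g} → f ≋ g → f ≃ g [mod m ]
  ≋⇒≃ f≋g = coeffwise (λ i → ≈⇒mod (coeff-≈ f≋g i))

  ≃-setoid : Carrier → Setoid c (c ⊔ ℓ)
  ≃-setoid m = record
    { Carrier = Poly
    ; _≈_ = _≃_[mod m ]
    ; isEquivalence = record
      { refl = coeffwise (λ i → mod-refl)
      ; sym = λ f≃g → coeffwise (λ i → mod-sym (at f≃g i))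
      ; trans = λ f≃g g≃h → coeffwise (λ i → mod-trans (at f≃g i) (at g≃h i))
      }
    }

  ≃-refl : ∀ {m f} → f ≃ f [mod m ]
  ≃-refl {m} = Setoid.refl (≃-setoid m)

  ≃-sym : ∀ {m f g} → f ≃ g [mod m ] → g ≃ f [mod m ]
  ≃-sym {m} = Setoid.sym (≃-setoid m)

  ≃-trans : ∀ {m f g h} → f ≃ g [mod m ] → g ≃ h [mod m ] → f ≃ h [mod m ]
  ≃-trans {m} = Setoid.trans (≃-setoid m)

  drop₁ : Poly → Poly
  drop₁ [] = []
  drop₁ (_ ∷ f) = f

  ≃-drop₁ : ∀ {m} f g → f ≃ g [mod m ] → drop₁ f ≃ drop₁ g [mod m ]
  ≃-drop₁ [] [] f≃g = coeffwise (λ i → at f≃g (suc i))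
  ≃-drop₁ [] (_ ∷ _) f≃g = coeffwise (λ i → at f≃g (suc i))
  ≃-drop₁ (_ ∷ _) [] f≃g = coeffwise (λ i → at f≃g (suc i))
  ≃-drop₁ (_ ∷ _) (_ ∷ _) f≃g = coeffwise (λ i → at f≃g (suc i))

  coeff-addP : ∀ f g i → coeff (addP f g) i ≈ coeff f i + coeff g i
  coeff-addP [] g i = sym (+-identityˡ _)
  coeff-addP (a ∷ f) [] zero = sym (+-identityʳ a)
  coeff-addP (a ∷ f) [] (suc i) = sym (+-identityʳ _)
  coeff-addP (a ∷ f) (b ∷ g) zero = refl
  coeff-addP (a ∷ f) (b ∷ g) (suc i) = coeff-addP f g i

  coeff-scaleP : ∀ a f i → coeff (scaleP a f) i ≈ a * coeff f i
  coeff-scaleP a [] i = sym (zeroʳ a)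
  coeff-scaleP a (b ∷ f) zero = refl
  coeff-scaleP a (b ∷ f) (suc i) = coeff-scaleP a f i

  zero∷[]≋[] : (0# ∷ []) ≋ []
  zero∷[]≋[] = exactly λ { zero → refl ; (suc i) → refl }

  addP-nilʳ : ∀ A → addP A [] ≋ A
  addP-nilʳ A = exactly λ i → trans (coeff-addP A [] i) (+-identityʳ _)

  addP-zeroˡ : ∀ A → addP (0# ∷ []) A ≋ A
  addP-zeroˡ A = exactly λ i → trans (coeff-addP (0# ∷ []) A i) (trans (+-congʳ (coeff-≈ zero∷[]≋[] i)) (+-identityˡ _))

  addP-interchange : ∀ A B C D → addP (addP A B) (addP C D) ≋ addP (addP A C) (addP B D)
  addP-interchange A B C D = exactly λ i → trans (expand A B C D i)
    (trans (solve 4 (λ a b c d → a :+ b :+ (c :+ d) := a :+ c :+ (b :+ d)) refl (coeff A i) (coeff B i) (coeff C i) (coeff D i))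
           (sym (expand A C B D i)))
    where
    expand : ∀ A B C D i → coeff (addP (addP A B) (addP C D)) i ≈ coeff A i + coeff B i + (coeff C i + coeff D i)
    expand A B C D i = trans (coeff-addP (addP A B) (addP C D) i) (+-cong (coeff-addP A B i) (coeff-addP C D i))

  addP-swapʳ : ∀ A B C → addP (addP A B) C ≋ addP (addP A C) B
  addP-swapʳ A B C = exactly λ i → trans (expand A B C i)
    (trans (solve 3 (λ a b c → a :+ b :+ c := a :+ c :+ b) refl (coeff A i) (coeff B i) (coeff C i))
           (sym (expand A C B i)))
    where
    expand : ∀ A B C i → coeff (addP (addP A B) C) i ≈ coeff A i + coeff B i + coeff C i
    expand A B C i = trans (coeff-addP (addP A B) C i) (+-congʳ (coeff-addP A B i))

  scaleP-distrib : ∀ a A B → scaleP a (addP A B) ≋ addP (scaleP a A) (scaleP a B)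
  scaleP-distrib a A B = exactly λ i → trans (coeff-scaleP a (addP A B) i)
    (trans (*-congˡ (coeff-addP A B i))
    (trans (distribˡ a (coeff A i) (coeff B i))
           (sym (trans (coeff-addP (scaleP a A) (scaleP a B) i) (+-cong (coeff-scaleP a A i) (coeff-scaleP a B i))))))

  scaleP-comm : ∀ a b A → scaleP a (scaleP b A) ≋ scaleP b (scaleP a A)
  scaleP-comm a b A = exactly λ i → trans (coeff-scaleP a (scaleP b A) i)
    (trans (*-congˡ (coeff-scaleP b A i))
    (trans (solve 3 (λ a b x → a :* (b :* x) := b :* (a :* x)) refl a b (coeff A i))
           (sym (trans (coeff-scaleP b (scaleP a A) i) (*-congˡ (coeff-scaleP a A i))))))

  scaleP-zeroˡ : ∀ A → scaleP 0# A ≋ []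
  scaleP-zeroˡ A = exactly λ i → trans (coeff-scaleP 0# A i) (zeroˡ _)

  scaleP-oneˡ : ∀ A → scaleP 1# A ≋ A
  scaleP-oneˡ A = exactly λ i → trans (coeff-scaleP 1# A i) (*-identityˡ _)

  module Modulo {m : Carrier} where
    open SetoidReasoning (≃-setoid m)

    cons-cong : ∀ {x y f g} → x ≡ y [mod m ] → f ≃ g [mod m ] → (x ∷ f) ≃ (y ∷ g) [mod m ]
    cons-cong x≡y f≃g = coeffwise λ { zero → x≡y ; (suc i) → at f≃g i }

    addP-cong : ∀ {f f′ g g′} → f ≃ f′ [mod m ] → g ≃ g′ [mod m ] → addP f g ≃ addP f′ g′ [mod m ]
    addP-cong {f} {f′} {g} {g′} f≃ g≃ = coeffwise λ i →
      mod-trans (≈⇒mod (coeff-addP f g i)) (mod-trans (mod-+ (at f≃ i) (at g≃ i)) (≈⇒mod (sym (coeff-addP f′ g′ i))))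

    scaleP-cong : ∀ {x y f g} → x ≡ y [mod m ] → f ≃ g [mod m ] → scaleP x f ≃ scaleP y g [mod m ]
    scaleP-cong {x} {y} {f} {g} x≡y f≃g = coeffwise λ i →
      mod-trans (≈⇒mod (coeff-scaleP x f i)) (mod-trans (mod-* x≡y (at f≃g i)) (≈⇒mod (sym (coeff-scaleP y g i))))

    horner-cong : (F : Poly → Poly) (S : Carrier → Poly → Poly) →
                  F [] ≃ [] [mod m ] → (∀ a P → F (a ∷ P) ≃ S a (F P) [mod m ]) →
                  (∀ {a b A B} → a ≡ b [mod m ] → A ≃ B [mod m ] → S a A ≃ S b B [mod m ]) →
                  S 0# [] ≃ [] [mod m ] →
                  ∀ P Q → P ≃ Q [mod m ] → F P ≃ F Q [mod m ]
    horner-cong F S F[] F∷ S-cong S0 = go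
      where
      -- F [] ≃ S 0 (F []): the empty list may be read as 0 ∷ []
      F[]-unfold : F [] ≃ S 0# (F []) [mod m ]
      F[]-unfold = begin
        F []         ≈⟨ F[] ⟩
        []           ≈⟨ ≃-sym S0 ⟩
        S 0# []      ≈⟨ S-cong mod-refl (≃-sym F[]) ⟩
        S 0# (F [])  ∎

      go : ∀ P Q → P ≃ Q [mod m ] → F P ≃ F Q [mod m ]
      go [] [] P≃Q = ≃-refl
      go [] (b ∷ Q) P≃Q = begin
        F []          ≈⟨ F[]-unfold ⟩
        S 0# (F [])   ≈⟨ S-cong (at P≃Q 0) (go [] Q (≃-drop₁ [] (b ∷ Q) P≃Q)) ⟩
        S b (F Q)     ≈⟨ ≃-sym (F∷ b Q) ⟩
        F (b ∷ Q)     ∎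
      go (a ∷ P) [] P≃Q = begin
        F (a ∷ P)     ≈⟨ F∷ a P ⟩
        S a (F P)     ≈⟨ S-cong (at P≃Q 0) (go P [] (≃-drop₁ (a ∷ P) [] P≃Q)) ⟩
        S 0# (F [])   ≈⟨ ≃-sym F[]-unfold ⟩
        F []          ∎
      go (a ∷ P) (b ∷ Q) P≃Q = begin
        F (a ∷ P)     ≈⟨ F∷ a P ⟩
        S a (F P)     ≈⟨ S-cong (at P≃Q 0) (go P Q (≃-drop₁ (a ∷ P) (b ∷ Q) P≃Q)) ⟩
        S b (F Q)     ≈⟨ ≃-sym (F∷ b Q) ⟩
        F (b ∷ Q)     ∎

    mulP-congʳ : ∀ g {A B} → A ≃ B [mod m ] → mulP g A ≃ mulP g B [mod m ]
    mulP-congʳ [] A≃B = ≃-refl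
    mulP-congʳ (a ∷ g) A≃B = addP-cong (scaleP-cong mod-refl A≃B) (cons-cong mod-refl (mulP-congʳ g A≃B))

    mulP-congˡ : ∀ P Q g → P ≃ Q [mod m ] → mulP P g ≃ mulP Q g [mod m ]
    mulP-congˡ P Q g = horner-cong (λ P → mulP P g) (λ a A → addP (scaleP a g) (0# ∷ A))
      ≃-refl (λ a P → ≃-refl)
      (λ a≡b A≃B → addP-cong (scaleP-cong a≡b ≃-refl) (cons-cong mod-refl A≃B))
      (≋⇒≃ (exactly λ i → trans (coeff-addP (scaleP 0# g) (0# ∷ []) i)
                 (trans (+-cong (coeff-≈ (scaleP-zeroˡ g) i) (coeff-≈ zero∷[]≋[] i)) (+-identityʳ 0#))))
      P Q

    mulP-nilʳ : ∀ g → mulP g [] ≃ [] [mod m ]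
    mulP-nilʳ [] = ≃-refl
    mulP-nilʳ (a ∷ g) = begin
      (0# ∷ mulP g [])  ≈⟨ cons-cong mod-refl (mulP-nilʳ g) ⟩
      (0# ∷ [])         ≈⟨ ≋⇒≃ zero∷[]≋[] ⟩
      []                ∎

    mulP-oneʳ : ∀ g → mulP g (1# ∷ []) ≃ g [mod m ]
    mulP-oneʳ [] = ≃-refl
    mulP-oneʳ (a ∷ g) = cons-cong (≈⇒mod (trans (+-identityʳ _) (*-identityʳ a))) (mulP-oneʳ g)

    mulP-oneˡ : ∀ A → mulP (1# ∷ []) A ≃ A [mod m ]
    mulP-oneˡ A = begin
      addP (scaleP 1# A) (0# ∷ [])  ≈⟨ addP-cong (≋⇒≃ (scaleP-oneˡ A)) (≋⇒≃ zero∷[]≋[]) ⟩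
      addP A []                     ≈⟨ ≋⇒≃ (addP-nilʳ A) ⟩
      A                             ∎

    mulP-Xˡ : ∀ A → mulP X A ≃ (0# ∷ A) [mod m ]
    mulP-Xˡ A = addP-cong (≋⇒≃ (scaleP-zeroˡ A)) (cons-cong mod-refl (mulP-oneˡ A))

    mulP-distribˡ : ∀ g A B → mulP g (addP A B) ≃ addP (mulP g A) (mulP g B) [mod m ]
    mulP-distribˡ [] A B = ≃-refl
    mulP-distribˡ (a ∷ g) A B = begin
      addP (scaleP a (addP A B)) (0# ∷ mulP g (addP A B))
        ≈⟨ addP-cong (≋⇒≃ (scaleP-distrib a A B)) (cons-cong (≈⇒mod (sym (+-identityʳ 0#))) (mulP-distribˡ g A B)) ⟩
      addP (addP (scaleP a A) (scaleP a B)) (addP (0# ∷ mulP g A) (0# ∷ mulP g B))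
        ≈⟨ ≋⇒≃ (addP-interchange (scaleP a A) (scaleP a B) (0# ∷ mulP g A) (0# ∷ mulP g B)) ⟩
      addP (mulP (a ∷ g) A) (mulP (a ∷ g) B) ∎

    mulP-scaleP : ∀ b g A → mulP g (scaleP b A) ≃ scaleP b (mulP g A) [mod m ]
    mulP-scaleP b [] A = ≃-refl
    mulP-scaleP b (a ∷ g) A = begin
      addP (scaleP a (scaleP b A)) (0# ∷ mulP g (scaleP b A))
        ≈⟨ addP-cong (≋⇒≃ (scaleP-comm a b A)) (cons-cong (≈⇒mod (sym (zeroʳ b))) (mulP-scaleP b g A)) ⟩
      addP (scaleP b (scaleP a A)) (scaleP b (0# ∷ mulP g A))
        ≈⟨ ≃-sym (≋⇒≃ (scaleP-distrib b (scaleP a A) (0# ∷ mulP g A))) ⟩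
      scaleP b (mulP (a ∷ g) A) ∎

    compP-congˡ : ∀ P Q g → P ≃ Q [mod m ] → compP P g ≃ compP Q g [mod m ]
    compP-congˡ P Q g = horner-cong (λ P → compP P g) (λ a A → addP (a ∷ []) (mulP g A))
      ≃-refl (λ a P → ≃-refl)
      (λ a≡b A≃B → addP-cong (cons-cong a≡b ≃-refl) (mulP-congʳ g A≃B))
      (begin
        addP (0# ∷ []) (mulP g [])  ≈⟨ addP-cong ≃-refl (mulP-nilʳ g) ⟩
        (0# ∷ [])                   ≈⟨ ≋⇒≃ zero∷[]≋[] ⟩
        []                          ∎)
      P Q

    compP-congʳ : ∀ P {g h} → g ≃ h [mod m ] → compP P g ≃ compP P h [mod m ]
    compP-congʳ [] g≃h = ≃-refl
    compP-congʳ (a ∷ P) {g} {h} g≃h =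
      addP-cong ≃-refl (≃-trans (mulP-congˡ g h (compP P g) g≃h) (mulP-congʳ h (compP-congʳ P g≃h)))

    compP-addP : ∀ P Q g → compP (addP P Q) g ≃ addP (compP P g) (compP Q g) [mod m ]
    compP-addP [] Q g = ≃-refl
    compP-addP (a ∷ P) [] g = ≃-sym (≋⇒≃ (addP-nilʳ _))
    compP-addP (a ∷ P) (b ∷ Q) g = begin
      addP ((a + b) ∷ []) (mulP g (compP (addP P Q) g))
        ≈⟨ addP-cong ≃-refl (≃-trans (mulP-congʳ g (compP-addP P Q g)) (mulP-distribˡ g (compP P g) (compP Q g))) ⟩
      addP (addP (a ∷ []) (b ∷ [])) (addP (mulP g (compP P g)) (mulP g (compP Q g)))
        ≈⟨ ≋⇒≃ (addP-interchange (a ∷ []) (b ∷ []) (mulP g (compP P g)) (mulP g (compP Q g))) ⟩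
      addP (compP (a ∷ P) g) (compP (b ∷ Q) g) ∎

    compP-scaleP : ∀ b P g → compP (scaleP b P) g ≃ scaleP b (compP P g) [mod m ]
    compP-scaleP b [] g = ≃-refl
    compP-scaleP b (a ∷ P) g = begin
      addP (scaleP b (a ∷ [])) (mulP g (compP (scaleP b P) g))
        ≈⟨ addP-cong ≃-refl (≃-trans (mulP-congʳ g (compP-scaleP b P g)) (mulP-scaleP b g (compP P g))) ⟩
      addP (scaleP b (a ∷ [])) (scaleP b (mulP g (compP P g)))
        ≈⟨ ≃-sym (≋⇒≃ (scaleP-distrib b (a ∷ []) (mulP g (compP P g)))) ⟩
      scaleP b (compP (a ∷ P) g) ∎

    compP-Xˡ : ∀ g → compP X g ≃ g [mod m ]
    compP-Xˡ g = begin
      addP (0# ∷ []) (mulP g (addP (1# ∷ []) (mulP g [])))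
        ≈⟨ addP-cong ≃-refl (mulP-congʳ g (addP-cong ≃-refl (mulP-nilʳ g))) ⟩
      addP (0# ∷ []) (mulP g (1# ∷ []))
        ≈⟨ addP-cong ≃-refl (mulP-oneʳ g) ⟩
      addP (0# ∷ []) g
        ≈⟨ ≋⇒≃ (addP-zeroˡ g) ⟩
      g ∎

    compP-Xʳ : ∀ P → compP P X ≃ P [mod m ]
    compP-Xʳ [] = ≃-refl
    compP-Xʳ (a ∷ P) = begin
      addP (a ∷ []) (mulP X (compP P X))  ≈⟨ addP-cong (≃-refl {f = a ∷ []}) (mulP-Xˡ (compP P X)) ⟩
      ((a + 0#) ∷ compP P X)              ≈⟨ cons-cong (≈⇒mod (+-identityʳ a)) (compP-Xʳ P) ⟩
      (a ∷ P)                             ∎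

  open Modulo

  factor : ∀ {a} f g → f ≃ g [mod a ] → Σ Poly λ u → f ≋ addP g (scaleP a u)
  factor [] [] f≃g = [] , exactly (λ i → refl)
  factor [] (y ∷ g) f≃g with factor [] g (≃-drop₁ [] (y ∷ g) f≃g) | at f≃g 0
  ... | u , []≋ | d , 0≈ = d ∷ u , exactly λ { zero → 0≈ ; (suc i) → coeff-≈ []≋ i }
  factor {a} (x ∷ f) [] f≃g with factor f [] (≃-drop₁ (x ∷ f) [] f≃g) | at f≃g 0
  ... | u , f≋ | d , x≈ = d ∷ u , exactly λ { zero → trans x≈ (+-identityˡ (a * d)) ; (suc i) → coeff-≈ f≋ i }
  factor (x ∷ f) (y ∷ g) f≃g with factor f g (≃-drop₁ (x ∷ f) (y ∷ g) f≃g) | at f≃g 0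
  ... | u , f≋ | d , x≈ = d ∷ u , exactly λ { zero → x≈ ; (suc i) → coeff-≈ f≋ i }

  module Commute {a b k : Carrier} (a²≈bk : a * a ≈ b * k) where
    open SetoidReasoning (≃-setoid b)

    scaleP-mod : ∀ {P Q} → P ≃ Q [mod a ] → scaleP a P ≃ scaleP a Q [mod b ]
    scaleP-mod {P} {Q} P≃Q = coeffwise λ i →
      mod-trans (≈⇒mod (coeff-scaleP a P i))
      (mod-trans (mod-weaken a²≈bk (mod-scale (at P≃Q i))) (≈⇒mod (sym (coeff-scaleP a Q i))))

    near-identity-comp : ∀ u g → g ≃ X [mod a ] → compP (addP X (scaleP a u)) g ≃ addP g (scaleP a u) [mod b ]
    near-identity-comp u g g≃X = begin
      compP (addP X (scaleP a u)) g              ≈⟨ compP-addP X (scaleP a u) g ⟩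
      addP (compP X g) (compP (scaleP a u) g)    ≈⟨ addP-cong (compP-Xˡ g) (compP-scaleP a u g) ⟩
      addP g (scaleP a (compP u g))              ≈⟨ addP-cong ≃-refl (scaleP-mod u∘g≃u) ⟩
      addP g (scaleP a u)                        ∎
      where
      u∘g≃u : compP u g ≃ u [mod a ]
      u∘g≃u = ≃-trans (compP-congʳ u g≃X) (compP-Xʳ u)

    -- the main lemma: writing f = T + a·u and g = T + a·v, both composites
    -- are ≡ T + a·u + a·v (mod b)
    commute : ∀ f g → f ≃ X [mod a ] → g ≃ X [mod a ] → compP f g ≃ compP g f [mod b ]
    commute f g f≃X g≃X with factor f X f≃X | factor g X g≃X
    ... | u , f≋ | v , g≋ = begin
      compP f g                                    ≈⟨ compP-congˡ f _ g (≋⇒≃ f≋) ⟩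
      compP (addP X (scaleP a u)) g                ≈⟨ near-identity-comp u g g≃X ⟩
      addP g (scaleP a u)                          ≈⟨ addP-cong (≋⇒≃ g≋) ≃-refl ⟩
      addP (addP X (scaleP a v)) (scaleP a u)      ≈⟨ ≋⇒≃ (addP-swapʳ X (scaleP a v) (scaleP a u)) ⟩
      addP (addP X (scaleP a u)) (scaleP a v)      ≈⟨ ≃-sym (addP-cong (≋⇒≃ f≋) ≃-refl) ⟩
      addP f (scaleP a v)                          ≈⟨ ≃-sym (near-identity-comp v f f≃X) ⟩
      compP (addP X (scaleP a v)) f                ≈⟨ ≃-sym (compP-congˡ g _ f (≋⇒≃ g≋)) ⟩
      compP g f                                    ∎

  open Commute using (commute)

  pow-+ : ∀ q i j → pow q (i ℕ.+ j) ≈ pow q i * pow q j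
  pow-+ q zero j = sym (*-identityˡ _)
  pow-+ q (suc i) j = trans (*-congˡ (pow-+ q i j)) (sym (*-assoc q (pow q i) (pow q j)))

  pow-square-multiple : ∀ q n s → n ℕ.≤ s ℕ.+ s → pow q s * pow q s ≈ pow q n * pow q (s ℕ.+ s ℕ.∸ n)
  pow-square-multiple q n s n≤2s = trans (sym (pow-+ q s s))
    (trans (reflexive (P.cong (pow q) (P.sym (ℕₚ.m+[n∸m]≡n n≤2s)))) (pow-+ q n (s ℕ.+ s ℕ.∸ n)))

  half-bound : ∀ n r → n ℕ.< 2 ℕ.* r → n ℕ.≤ r ℕ.⊓ n ℕ.+ r ℕ.⊓ n
  half-bound n r n<2r with ℕₚ.≤-total r n
  ... | inj₁ r≤n rewrite ℕₚ.m≤n⇒m⊓n≡m r≤n | ℕₚ.+-identityʳ r = ℕₚ.<⇒≤ n<2r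
  ... | inj₂ n≤r rewrite ℕₚ.m≥n⇒m⊓n≡n n≤r = ℕₚ.m≤m+n n n

  congruent-to-T-commute : ∀ q n r → n ℕ.< 2 ℕ.* r → ∀ f g →
    f ≡ₚ X [mod q ^ r ℕ.⊓ n ] → g ≡ₚ X [mod q ^ r ℕ.⊓ n ] → compP f g ≡ₚ compP g f [mod q ^ n ]
  congruent-to-T-commute q n r n<2r f g f≡X g≡X =
    at (commute (pow-square-multiple q n (r ℕ.⊓ n) (half-bound n r n<2r)) f g (coeffwise f≡X) (coeffwise g≡X))

corollary4p5 : ∀ {c ℓ} (R : CommutativeRing c ℓ) → PolyDefs.Cor4p5 R
corollary4p5 R q _ n r n<2r =
  (λ f g f∈N g∈N → congruent-to-T-commute q n r n<2r f g (proj₂ f∈N) (proj₂ g∈N)) ,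
  (λ f g f∈K g∈K → congruent-to-T-commute q n r n<2r f g (proj₂ f∈K) (proj₂ g∈K))
  where open Proof R
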